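{- For any type $A:\mathcal U$, the following are logically equivalent: (1) for every $\alpha:\mathbb N\to 2$, $\Big(\prod_{n:\mathbb N}\big\lVert(\alpha_n=1)\to A\big\rVert\Big)\to\Big\lVert\prod_{n:\mathbb N}\big((\alpha_n=1)\to A\big)\Big\rVert$; (2) for every proposition $P:\mathcal U$ with $\operatorname{isRosolini}(P)$, $\big(P\to\lVert A\rVert\big)\to\lVert P\to A\rVert$.
   Context: Type theory: Martin-Löf type theory with universe $\mathcal U$, function extensionality, proposition extensionality and propositional truncations $\lVert X\rVert$. For $\alpha:\mathbb N\to 2$ let $\langle\alpha\rangle:=\sum_{n:\mathbb N}(\alpha_n=1)$; $\mathbb N_\infty:=\sum_{\alpha:\mathbb N\to2}\operatorname{isProp}(\langle\alpha\rangle)$. A type $P$ is Rosolini, $\operatorname{isRosolini}(P)$, if $\big\lVert\sum_{u:\mathbb N_\infty}(P=\langle u\rangle)\big\rVert$. -}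

module Defs where

open import Level using (Level; Setω; _⊔_) renaming (suc to lsuc)
open import Data.Nat using (ℕ)
open import Data.Bool using (Bool; true)
open import Data.Product using (Σ; _,_)
open import Relation.Binary.PropositionalEquality using (_≡_)
open import Axiom.Extensionality.Propositional using (Extensionality)

isProp : ∀ {ℓ} → Set ℓ → Set ℓ
isProp X = (x y : X) → x ≡ y

FunExt : Setω
FunExt = ∀ {a b} → Extensionality a b

PropExt : Set₁
PropExt = {P Q : Set} → isProp P → isProp Q → (P → Q) → (Q → P) → P ≡ Q

-- Propositional truncations (an abstract, universe-polymorphic structure,
-- since plain Agda has no higher inductive types).
record PropTrunc : Setω where
  field
    ∥_∥      : ∀ {ℓ} → Set ℓ → Set ℓ
    ∣_∣      : ∀ {ℓ} {X : Set ℓ} → X → ∥ X ∥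
    ∥∥-isProp : ∀ {ℓ} {X : Set ℓ} → isProp ∥ X ∥
    ∥∥-rec   : ∀ {ℓ ℓ'} {X : Set ℓ} {Y : Set ℓ'} → isProp Y → (X → Y) → ∥ X ∥ → Y

-- ⟨α⟩ := Σ (n : ℕ) (α n = 1)   (2 = Bool, 1 = true)
⟪_⟫ : (ℕ → Bool) → Set
⟪ α ⟫ = Σ ℕ (λ n → α n ≡ true)

ℕ∞ : Set
ℕ∞ = Σ (ℕ → Bool) (λ α → isProp ⟪ α ⟫)

⟨_⟩∞ : ℕ∞ → Set
⟨ (α , _) ⟩∞ = ⟪ α ⟫

module _ (pt : PropTrunc) where
  open PropTrunc pt

  isRosolini : Set → Set₁
  isRosolini P = ∥ Σ ℕ∞ (λ u → P ≡ ⟨ u ⟩∞) ∥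

  Cond1 : Set → Set
  Cond1 A = (α : ℕ → Bool)
          → ((n : ℕ) → ∥ (α n ≡ true → A) ∥)
          → ∥ ((n : ℕ) → α n ≡ true → A) ∥

  Cond2 : Set → Set₁
  Cond2 A = (P : Set) → isProp P → isRosolini P
          → (P → ∥ A ∥) → ∥ (P → A) ∥

-- (1) ⇒ (2): a Rosolini proposition is merely equal to some ⟨α⟩, and P → ∥ A ∥ then gives,
-- by deciding each αₙ, the premise ∥ (αₙ = 1) → A ∥ of (1).
-- (2) ⇒ (1): for an arbitrary α, keeping only its first 1 yields a sequence α′ ∈ ℕ∞ with
-- ⟨α′⟩ logically equivalent to ⟨α⟩, so (2) applies to the Rosolini proposition ⟨α′⟩.
module Submission where

open import Defs
open import Function.Base using (_∘_)
open import Function.Bundles using (_⇔_; mk⇔)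
open import Data.Nat using (ℕ; zero; suc; _<_)
open import Data.Nat.Properties using (<-cmp; m<1+n⇒m<n∨m≡n; n<1+n)
open import Data.Bool using (Bool; true; false; _∧_; _∨_; not; _≟_)
open import Data.Bool.Properties using (∨-zeroʳ; ∨-identityʳ)
open import Data.Product using (Σ; _×_; _,_)
open import Data.Sum using (inj₁; inj₂)
open import Relation.Nullary using (Dec; yes; no; contradiction)
open import Relation.Binary.Definitions using (tri<; tri≈; tri>)
open import Relation.Binary.PropositionalEquality using (_≡_; refl; sym; trans; cong)
open import Axiom.UniquenessOfIdentityProofs using (module Decidable⇒UIP)

anyBelow : (ℕ → Bool) → ℕ → Bool
anyBelow α zero    = false
anyBelow α (suc n) = α n ∨ anyBelow α n

firstTrue : (ℕ → Bool) → ℕ → Bool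
firstTrue α n = α n ∧ not (anyBelow α n)

module _ (α : ℕ → Bool) where

  anyBelow-true : ∀ {m n} → α m ≡ true → m < n → anyBelow α n ≡ true
  anyBelow-true {m} {suc n} αm≡true m<1+n with m<1+n⇒m<n∨m≡n m<1+n
  ... | inj₁ m<n  rewrite anyBelow-true αm≡true m<n = ∨-zeroʳ (α n)
  ... | inj₂ refl rewrite αm≡true = refl

  firstTrue-intro : ∀ {n} → α n ≡ true → anyBelow α n ≡ false → firstTrue α n ≡ true
  firstTrue-intro αn≡true below≡false rewrite αn≡true | below≡false = refl

  firstTrue-elim : ∀ n → firstTrue α n ≡ true → α n ≡ true × anyBelow α n ≡ false
  firstTrue-elim n p with α n | anyBelow α n
  firstTrue-elim n p  | true  | false = refl , refl
  firstTrue-elim n () | true  | true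
  firstTrue-elim n () | false | _

  firstTrue⇒true : ∀ {n} → firstTrue α n ≡ true → α n ≡ true
  firstTrue⇒true {n} p with firstTrue-elim n p
  ... | αn≡true , _ = αn≡true

  firstTrue-isProp : isProp ⟪ firstTrue α ⟫
  firstTrue-isProp (m , p) (n , q) with firstTrue-elim m p | firstTrue-elim n q | <-cmp m n
  ... | αm , _ | _ , none<n | tri< m<n _ _ = contradiction (trans (sym (anyBelow-true αm m<n)) none<n) λ ()
  ... | _ , none<m | αn , _ | tri> _ _ n<m = contradiction (trans (sym (anyBelow-true αn n<m)) none<m) λ ()
  ... | _ | _ | tri≈ _ refl _ = cong (m ,_) (Decidable⇒UIP.≡-irrelevant _≟_ p q)

  anyBelow⇒firstTrue : ∀ n → anyBelow α n ≡ true → ⟪ firstTrue α ⟫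
  anyBelow⇒firstTrue (suc n) p with anyBelow α n in below
  ... | true  = anyBelow⇒firstTrue n below
  ... | false = n , firstTrue-intro (trans (sym (∨-identityʳ (α n))) p) below

  ⟪⟫⇒⟪firstTrue⟫ : ⟪ α ⟫ → ⟪ firstTrue α ⟫
  ⟪⟫⇒⟪firstTrue⟫ (n , αn) = anyBelow⇒firstTrue (suc n) (anyBelow-true αn (n<1+n n))

  ⟪firstTrue⟫⇒⟪⟫ : ⟪ firstTrue α ⟫ → ⟪ α ⟫
  ⟪firstTrue⟫⇒⟪⟫ (n , p) = n , firstTrue⇒true p

firstTrue∞ : (ℕ → Bool) → ℕ∞
firstTrue∞ α = firstTrue α , firstTrue-isProp α

module _ (pt : PropTrunc) where
  open PropTrunc pt

  ∥∥-map : ∀ {a b} {X : Set a} {Y : Set b} → (X → Y) → ∥ X ∥ → ∥ Y ∥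
  ∥∥-map f = ∥∥-rec ∥∥-isProp (λ x → ∣ f x ∣)

  ∥→∥-dec : ∀ {P X : Set} → Dec P → (P → ∥ X ∥) → ∥ (P → X) ∥
  ∥→∥-dec (yes p) f = ∥∥-map (λ x _ → x) (f p)
  ∥→∥-dec (no ¬p) f = ∣ (λ p → contradiction p ¬p) ∣

  Cond1⇒choice-⟪⟫ : ∀ {A} → Cond1 pt A → (α : ℕ → Bool) → (⟪ α ⟫ → ∥ A ∥) → ∥ (⟪ α ⟫ → A) ∥
  Cond1⇒choice-⟪⟫ c1 α f =
    ∥∥-map (λ g (n , αn) → g n αn) (c1 α (λ n → ∥→∥-dec (α n ≟ true) (λ αn → f (n , αn))))

  Cond2⇒choice-⟪⟫ : ∀ {A} → Cond2 pt A → (α : ℕ → Bool) → (⟪ α ⟫ → ∥ A ∥) → ∥ (⟪ α ⟫ → A) ∥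
  Cond2⇒choice-⟪⟫ c2 α f =
    ∥∥-map (λ g → g ∘ ⟪⟫⇒⟪firstTrue⟫ α)
      (c2 ⟪ firstTrue α ⟫ (firstTrue-isProp α) ∣ firstTrue∞ α , refl ∣ (f ∘ ⟪firstTrue⟫⇒⟪⟫ α))

  Cond1⇒Cond2 : ∀ {A} → Cond1 pt A → Cond2 pt A
  Cond1⇒Cond2 {A} c1 P _ rosolini f = ∥∥-rec ∥∥-isProp choice rosolini
    where
    choice : Σ ℕ∞ (λ u → P ≡ ⟨ u ⟩∞) → ∥ (P → A) ∥
    choice ((α , _) , refl) = Cond1⇒choice-⟪⟫ c1 α f

  Cond2⇒Cond1 : ∀ {A} → Cond2 pt A → Cond1 pt A
  Cond2⇒Cond1 c2 α g =
    ∥∥-map (λ h n αn → h (n , αn))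
      (Cond2⇒choice-⟪⟫ c2 α (λ (n , αn) → ∥∥-map (λ k → k αn) (g n)))

theorem5p29 : (pt : PropTrunc) → FunExt → PropExt → (A : Set)
            → Cond1 pt A ⇔ Cond2 pt A
theorem5p29 pt _ _ A = mk⇔ (Cond1⇒Cond2 pt) (Cond2⇒Cond1 pt)
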